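{- Let $M,N$ be sharp, integral monoids, let $\Gamma$ be an $M$-metrised graph, let $f:M\to N$ be a homomorphism, and let $\Gamma'$ be the edge contraction of $\Gamma$ along $f$. Then $\operatorname{dgon}(\Gamma')\le\operatorname{dgon}(\Gamma)$.
   Context: Monoids: commutative, sharp, integral; $(\cdot)^{gp}$ groupification. A graph is $(X,r,i)$: $X$ finite, $r$ idempotent, $i$ involution, $i(x)=x\iff r(x)=x$; vertices $V$ = fixed points, half-edges $H=X\setminus V$, $H_v=\{e:r(e)=v\}$; connected. $M$-metrised: $l:X\to M$, $l\circ i=l$, $l(x)=0\iff x\in V$. $\operatorname{PL}(\Gamma)=\{g:V\to M^{gp}: g(r(e))-g(r(i(e)))\in\langle l(e)\rangle\}$; $\Delta(g)=\sum_v\sum_{e\in H_v}\frac{g(v)-g(r(i(e)))}{l(e)}[v]$; $D\sim D'$ iff $D-D'\in\Delta(\operatorname{PL}(\Gamma))$; $|D|=\{E\ge0:E\sim D\}$; $r(D)=\max\{k:|D-F|\ne\emptyset$ for all effective $F$ of degree $k\}$; $\operatorname{dgon}(\Gamma)=\min\{\deg D:r(D)\ge1\}$. The edge contraction $\Gamma'$ along $f$ is the quotient of $X$ identifying $e\sim r(e)\sim i(e)\sim r(i(e))$ whenever $f(l(e))=0$, with length function $f\circ l$. -}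

module Defs where

open import Level using (Level; _⊔_; 0ℓ)
open import Algebra.Bundles using (CommutativeMonoid)
open import Algebra.Morphism.Structures using (module MonoidMorphisms)
open import Data.Nat using (ℕ; zero; suc)
open import Data.Integer as ℤ using (ℤ; +_; -[1+_]; 0ℤ)
open import Data.Fin using (Fin; zero; suc; _≟_)
open import Data.Bool using (if_then_else_; _∧_; not)
open import Data.Product using (Σ; ∃; ∃-syntax; _×_; _,_)
open import Data.Sum using (_⊎_)
open import Function using (_∘_)
open import Relation.Binary.PropositionalEquality using (_≡_; _≢_)
open import Relation.Nullary using (does)
open import Relation.Binary.Construct.Closure.Equivalence using (EqClosure)

module _ {c ℓ} (M : CommutativeMonoid c ℓ) where
  open CommutativeMonoid M renaming (Carrier to A)

  Sharp : Set (c ⊔ ℓ)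
  Sharp = ∀ x y → (x ∙ y) ≈ ε → x ≈ ε

  Integral : Set (c ⊔ ℓ)
  Integral = ∀ x y z → (x ∙ y) ≈ (x ∙ z) → y ≈ z

  -- Groupification M^gp: formal differences (a , b) = a - b,
  -- (a , b) ~ (c , d) iff a + d + k = b + c + k for some k.
  Gp : Set c
  Gp = A × A

  _≈gp_ : Gp → Gp → Set (c ⊔ ℓ)
  (a , b) ≈gp (c' , d) = ∃[ k ] (((a ∙ d) ∙ k) ≈ ((b ∙ c') ∙ k))

  _−gp_ : Gp → Gp → Gp
  (a , b) −gp (c' , d) = (a ∙ d , b ∙ c')

  _·ℕ_ : ℕ → A → A
  zero ·ℕ x = ε
  suc k ·ℕ x = x ∙ (k ·ℕ x)

  _·ℤ_ : ℤ → A → Gp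
  (+ k) ·ℤ x = (k ·ℕ x , ε)
  -[1+ k ] ·ℤ x = (ε , suc k ·ℕ x)

  IsHom : ∀ {c₂ ℓ₂} (N : CommutativeMonoid c₂ ℓ₂) →
          (A → CommutativeMonoid.Carrier N) → Set (c ⊔ ℓ ⊔ ℓ₂)
  IsHom N f = MonoidMorphisms.IsMonoidHomomorphism
                (CommutativeMonoid.rawMonoid M) (CommutativeMonoid.rawMonoid N) f

-- reachability between vertices along edges (half-edge e joins r e and r (i e))
data Reach {n : ℕ} (r i : Fin n → Fin n) (v : Fin n) : Fin n → Set where
  here : Reach r i v v
  step : ∀ {e} → Reach r i v (r e) → r e ≢ e → Reach r i v (r (i e))

record MetrisedGraph {c ℓ} (M : CommutativeMonoid c ℓ) : Set (c ⊔ ℓ) where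
  open CommutativeMonoid M renaming (Carrier to A)
  field
    n       : ℕ
    r       : Fin n → Fin n
    i       : Fin n → Fin n
    r-idem  : ∀ x → r (r x) ≡ r x
    i-invol : ∀ x → i (i x) ≡ x
    fixed   : ∀ x → (i x ≡ x → r x ≡ x) × (r x ≡ x → i x ≡ x)
    connected : ∀ v w → r v ≡ v → r w ≡ w → Reach r i v w
    l       : Fin n → A
    l-i     : ∀ x → l (i x) ≈ l x
    l-zero  : ∀ x → (l x ≈ ε → r x ≡ x) × (r x ≡ x → l x ≈ ε)

∑ : ∀ {n} → (Fin n → ℤ) → ℤ
∑ {zero} f = 0ℤ
∑ {suc n} f = f zero ℤ.+ ∑ (f ∘ suc)

module _ {c ℓ} {M : CommutativeMonoid c ℓ} (Γ : MetrisedGraph M) where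
  open CommutativeMonoid M renaming (Carrier to A)
  open MetrisedGraph Γ

  -- divisors: integer functions on X supported on the vertex set V
  IsDivisor : (Fin n → ℤ) → Set
  IsDivisor D = ∀ x → r x ≢ x → D x ≡ 0ℤ

  deg : (Fin n → ℤ) → ℤ
  deg D = ∑ D

  Effective : (Fin n → ℤ) → Set
  Effective D = IsDivisor D × (∀ x → 0ℤ ℤ.≤ D x)

  -- piecewise linear functions g : V → M^gp (values off V are irrelevant);
  -- slope e is the integer (g(r e) - g(r(i e))) / l(e), which exists by the
  -- PL condition and is unique because M is sharp and integral
  record PL : Set (c ⊔ ℓ) where
    field
      g     : Fin n → Gp M
      slope : Fin n → ℤ
      slope-spec : ∀ e → r e ≢ e →
        _≈gp_ M (_−gp_ M (g (r e)) (g (r (i e)))) (_·ℤ_ M (slope e) (l e))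

  -- Δ(g)(v) = Σ_{e ∈ H_v} (g(v) - g(r(i e))) / l(e)
  Δ : PL → Fin n → ℤ
  Δ φ v = ∑ (λ e → if does (r e ≟ v) ∧ not (does (e ≟ v))
                      then PL.slope φ e else 0ℤ)

  _∼_ : (Fin n → ℤ) → (Fin n → ℤ) → Set (c ⊔ ℓ)
  D ∼ D' = ∃[ φ ] (∀ x → D x ℤ.- D' x ≡ Δ φ x)

  LinSysNonempty : (Fin n → ℤ) → Set (c ⊔ ℓ)
  LinSysNonempty D = ∃[ E ] (Effective E × (E ∼ D))

  -- k belongs to the set whose maximum is r(D)
  RankWitness : (Fin n → ℤ) → ℕ → Set (c ⊔ ℓ)
  RankWitness D k = ∀ F → Effective F → deg F ≡ + k →
                    LinSysNonempty (λ x → D x ℤ.- F x)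

  -- r(D) ≥ 1 : the maximum of {k : ...} is at least 1
  RankAtLeastOne : (Fin n → ℤ) → Set (c ⊔ ℓ)
  RankAtLeastOne D = ∃[ k ] ((1 Data.Nat.≤ k) × RankWitness D k)

module _ {c₁ ℓ₁ c₂ ℓ₂} {M : CommutativeMonoid c₁ ℓ₁} {N : CommutativeMonoid c₂ ℓ₂}
         (Γ : MetrisedGraph M) (f : CommutativeMonoid.Carrier M → CommutativeMonoid.Carrier N)
         where
  open MetrisedGraph Γ
  module N = CommutativeMonoid N

  Among : Fin n → Fin n → Set
  Among x e = x ≡ e ⊎ x ≡ r e ⊎ x ≡ i e ⊎ x ≡ r (i e)

  Gen : Fin n → Fin n → Set ℓ₂
  Gen x y = ∃[ e ] ((f (l e) N.≈ N.ε) × Among x e × Among y e)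

  record IsContraction (Γ' : MetrisedGraph N)
         (q : Fin n → Fin (MetrisedGraph.n Γ')) : Set (ℓ₂ ⊔ c₂) where
    module Γ' = MetrisedGraph Γ'
    field
      surjective : ∀ y → ∃[ x ] (q x ≡ y)
      kernel     : ∀ x y → (q x ≡ q y → EqClosure Gen x y) × (EqClosure Gen x y → q x ≡ q y)
      r-comm     : ∀ x → q (r x) ≡ Γ'.r (q x)
      i-comm     : ∀ x → q (i x) ≡ Γ'.i (q x)
      l-comm     : ∀ x → Γ'.l (q x) N.≈ f (l x)

{-# OPTIONS --safe #-}
-- Push divisors forward along the contraction q : X → X'. The pushforward q_* preserves
-- effectivity and degree, and has an effective, degree-preserving right inverse on divisors
-- (put the coefficient of a vertex y of Γ' on the vertex of a chosen preimage of y).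
-- A PL function φ on Γ induces one on Γ': apply f to its values, which is well defined
-- because f kills the length of every contracted edge, and keep the slopes of the surviving
-- edges. Then q_*(Δφ) = Δ(f_*φ): writing Δφ = r_*σ with σ the slope along each half-edge,
-- q_*σ is the slope of f_*φ on surviving half-edges and vanishes over vertices of Γ',
-- because σ is odd under i and every fibre over a vertex is i-stable. Oddness of σ is
-- uniqueness of slopes, which is where M sharp and integral is used. Hence q_* maps
-- |D - F| into |q_*D - q_*F|, so r(q_*D) ≥ r(D), and deg q_*D = deg D.
module Submission where

open import Defs
open import Algebra.Bundles using (CommutativeMonoid)
open import Algebra.Morphism.Structures using (module MonoidMorphisms)
open import Data.Bool using (Bool; true; false; if_then_else_; _∧_; not)
open import Data.Empty using (⊥-elim)
open import Data.Fin using (Fin; zero; suc; _≟_)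
open import Data.Fin.Permutation using (permutation)
open import Data.Integer as ℤ using (ℤ; +_; -[1+_]; 0ℤ; _+_; _-_; -_; _≤_)
import Data.Integer.Properties as ℤ
open import Data.Nat using (ℕ; zero; suc)
open import Data.Nat.Properties using (suc-injective)
open import Data.Product using (∃-syntax; _×_; _,_; proj₁; proj₂)
open import Data.Sum using (inj₁; inj₂)
open import Function using (_∘_; const)
open import Level using (_⊔_)
open import Relation.Binary.Bundles using (Setoid)
open import Relation.Binary.Structures using (IsEquivalence)
open import Relation.Binary.Construct.Closure.Equivalence using (EqClosure; gfold; return)
open import Relation.Binary.Construct.Closure.ReflexiveTransitive as Star using (_◅_)
open import Relation.Binary.Construct.Closure.Symmetric using (fwd; bwd)
import Relation.Binary.PropositionalEquality as ≡
open ≡ using (_≡_; _≢_)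
open import Relation.Nullary using (¬_; does; yes; no)

open import Algebra.Properties.CommutativeMonoid.Sum ℤ.+-0-commutativeMonoid
  using (sum; sum-cong-≗; sum-replicate-zero; ∑-comm; ∑-distrib-+; sum-permute)

module Groupification {c ℓ} (M : CommutativeMonoid c ℓ) where
  open CommutativeMonoid M renaming (Carrier to A)
  open import Algebra.Solver.CommutativeMonoid M using (solve; _⊜_; _⊕_)

  infix 4 _≈ᵍ_
  infixl 6 _-ᵍ_
  infixr 7 _·ᶻ_ _·ⁿ_

  _≈ᵍ_ : Gp M → Gp M → Set (c ⊔ ℓ)
  _≈ᵍ_ = _≈gp_ M

  _-ᵍ_ : Gp M → Gp M → Gp M
  _-ᵍ_ = _−gp_ M

  _·ⁿ_ : ℕ → A → A
  _·ⁿ_ = _·ℕ_ M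

  _·ᶻ_ : ℤ → A → Gp M
  _·ᶻ_ = _·ℤ_ M

  0ᵍ : Gp M
  0ᵍ = ε , ε

  -ᵍ_ : Gp M → Gp M
  -ᵍ (a , b) = b , a

  ≈-pair : ∀ {a b a' b'} → a ≈ a' → b ≈ b' → (a , b) ≈ᵍ (a' , b')
  ≈-pair {a} {b} {a'} {b'} a≈a' b≈b' = ε , ∙-congʳ (begin
    a ∙ b'  ≈⟨ ∙-cong a≈a' (sym b≈b') ⟩
    a' ∙ b  ≈⟨ comm a' b ⟩
    b ∙ a'  ∎)
    where open import Relation.Binary.Reasoning.Setoid setoid

  ≈ᵍ-isEquivalence : IsEquivalence _≈ᵍ_
  ≈ᵍ-isEquivalence = record { refl = ≈-pair refl refl ; sym = ≈ᵍ-sym ; trans = ≈ᵍ-trans }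
    where
    open import Relation.Binary.Reasoning.Setoid setoid
    ≈ᵍ-sym : ∀ {X Y} → X ≈ᵍ Y → Y ≈ᵍ X
    ≈ᵍ-sym {a , b} {a' , b'} (k , eq) = k , (begin
      (a' ∙ b) ∙ k  ≈⟨ ∙-congʳ (comm a' b) ⟩
      (b ∙ a') ∙ k  ≈⟨ sym eq ⟩
      (a ∙ b') ∙ k  ≈⟨ ∙-congʳ (comm a b') ⟩
      (b' ∙ a) ∙ k  ∎)
    ≈ᵍ-trans : ∀ {X Y Z} → X ≈ᵍ Y → Y ≈ᵍ Z → X ≈ᵍ Z
    ≈ᵍ-trans {a , b} {a' , b'} {a'' , b''} (k , eq) (k' , eq') = (a' ∙ b') ∙ (k ∙ k') , (begin
      (a ∙ b'') ∙ ((a' ∙ b') ∙ (k ∙ k'))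
        ≈⟨ solve 6 (λ a b'' a' b' k k' →
                      (a ⊕ b'') ⊕ ((a' ⊕ b') ⊕ (k ⊕ k')) ⊜ ((a ⊕ b') ⊕ k) ⊕ ((a' ⊕ b'') ⊕ k'))
                   refl a b'' a' b' k k' ⟩
      ((a ∙ b') ∙ k) ∙ ((a' ∙ b'') ∙ k')
        ≈⟨ ∙-cong eq eq' ⟩
      ((b ∙ a') ∙ k) ∙ ((b' ∙ a'') ∙ k')
        ≈⟨ solve 6 (λ b a'' a' b' k k' →
                      ((b ⊕ a') ⊕ k) ⊕ ((b' ⊕ a'') ⊕ k') ⊜ (b ⊕ a'') ⊕ ((a' ⊕ b') ⊕ (k ⊕ k')))
                   refl b a'' a' b' k k' ⟩
      (b ∙ a'') ∙ ((a' ∙ b') ∙ (k ∙ k'))  ∎)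

  gpSetoid : Setoid c (c ⊔ ℓ)
  gpSetoid = record { isEquivalence = ≈ᵍ-isEquivalence }

  open IsEquivalence ≈ᵍ-isEquivalence public
    using () renaming (refl to ≈ᵍ-refl; sym to ≈ᵍ-sym; trans to ≈ᵍ-trans; reflexive to ≈ᵍ-reflexive)

  -ᵍ-cong : ∀ {X Y X' Y'} → X ≈ᵍ X' → Y ≈ᵍ Y' → X -ᵍ Y ≈ᵍ X' -ᵍ Y'
  -ᵍ-cong {a , b} {u , v} {a' , b'} {u' , v'} (k , eq) (k' , eq') = k ∙ k' , (begin
    ((a ∙ v) ∙ (b' ∙ u')) ∙ (k ∙ k')
      ≈⟨ solve 6 (λ a v b' u' k k' →
                    ((a ⊕ v) ⊕ (b' ⊕ u')) ⊕ (k ⊕ k') ⊜ ((a ⊕ b') ⊕ k) ⊕ ((v ⊕ u') ⊕ k'))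
                 refl a v b' u' k k' ⟩
    ((a ∙ b') ∙ k) ∙ ((v ∙ u') ∙ k')
      ≈⟨ ∙-cong eq (sym eq') ⟩
    ((b ∙ a') ∙ k) ∙ ((u ∙ v') ∙ k')
      ≈⟨ solve 6 (λ b a' u v' k k' →
                    ((b ⊕ a') ⊕ k) ⊕ ((u ⊕ v') ⊕ k') ⊜ ((b ⊕ u) ⊕ (a' ⊕ v')) ⊕ (k ⊕ k'))
                 refl b a' u v' k k' ⟩
    ((b ∙ u) ∙ (a' ∙ v')) ∙ (k ∙ k')  ∎)
    where open import Relation.Binary.Reasoning.Setoid setoid

  -ᵍ-cong₁ : ∀ {X Y} → X ≈ᵍ Y → -ᵍ X ≈ᵍ -ᵍ Y
  -ᵍ-cong₁ (k , eq) = k , sym eq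

  -ᵍ-anticomm : ∀ X Y → X -ᵍ Y ≈ᵍ -ᵍ (Y -ᵍ X)
  -ᵍ-anticomm (a , b) (a' , b') = ≈-pair (comm a b') (comm b a')

  -ᵍ≈0⇒≈ : ∀ {X Y} → X -ᵍ Y ≈ᵍ 0ᵍ → X ≈ᵍ Y
  -ᵍ≈0⇒≈ {a , b} {a' , b'} (k , eq) =
    k , trans (∙-congʳ (sym (identityʳ _))) (trans eq (∙-congʳ (identityʳ _)))

  ·ⁿ-cong : ∀ m {x y} → x ≈ y → m ·ⁿ x ≈ m ·ⁿ y
  ·ⁿ-cong zero    x≈y = refl
  ·ⁿ-cong (suc m) x≈y = ∙-cong x≈y (·ⁿ-cong m x≈y)

  ·ᶻ-cong : ∀ s {x y} → x ≈ y → s ·ᶻ x ≈ᵍ s ·ᶻ y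
  ·ᶻ-cong (+ m)    x≈y = ≈-pair (·ⁿ-cong m x≈y) refl
  ·ᶻ-cong -[1+ m ] x≈y = ≈-pair refl (·ⁿ-cong (suc m) x≈y)

  ·ⁿ-ε : ∀ m → m ·ⁿ ε ≈ ε
  ·ⁿ-ε zero    = refl
  ·ⁿ-ε (suc m) = trans (identityˡ _) (·ⁿ-ε m)

  ·ᶻ-ε : ∀ s → s ·ᶻ ε ≈ᵍ 0ᵍ
  ·ᶻ-ε (+ m)    = ≈-pair (·ⁿ-ε m) refl
  ·ᶻ-ε -[1+ m ] = ≈-pair refl (·ⁿ-ε (suc m))

  ·ᶻ-neg : ∀ s x → (- s) ·ᶻ x ≡ -ᵍ (s ·ᶻ x)
  ·ᶻ-neg (+ zero)  x = ≡.refl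
  ·ᶻ-neg (+ suc m) x = ≡.refl
  ·ᶻ-neg -[1+ m ]  x = ≡.refl

  module Cancellation (sharp : Sharp M) (integral : Integral M) where

    sharpʳ : ∀ {x y} → x ∙ y ≈ ε → y ≈ ε
    sharpʳ {x} {y} xy≈ε = sharp y x (trans (comm y x) xy≈ε)

    ≈ᵍ⇒≈ : ∀ {a b a' b'} → (a , b) ≈ᵍ (a' , b') → a ∙ b' ≈ b ∙ a'
    ≈ᵍ⇒≈ {a} {b} {a'} {b'} (k , eq) = integral k _ _ (trans (comm k _) (trans eq (comm _ k)))

    ·ⁿ-cancelʳ : ∀ {x} → ¬ x ≈ ε → ∀ m n → m ·ⁿ x ≈ n ·ⁿ x → m ≡ n
    ·ⁿ-cancelʳ x≉ε zero    zero    _    = ≡.refl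
    ·ⁿ-cancelʳ x≉ε zero    (suc n) ε≈nx = ⊥-elim (x≉ε (sharp _ _ (sym ε≈nx)))
    ·ⁿ-cancelʳ x≉ε (suc m) zero    mx≈ε = ⊥-elim (x≉ε (sharp _ _ mx≈ε))
    ·ⁿ-cancelʳ x≉ε (suc m) (suc n) eq   = ≡.cong suc (·ⁿ-cancelʳ x≉ε m n (integral _ _ _ eq))

    ·ⁿ-suc-≉ε : ∀ {x} → ¬ x ≈ ε → ∀ m n → ¬ (m ·ⁿ x) ∙ (suc n ·ⁿ x) ≈ ε
    ·ⁿ-suc-≉ε x≉ε m n eq = x≉ε (sharp _ _ (sharpʳ eq))

    ·ᶻ-cancelʳ : ∀ {x} → ¬ x ≈ ε → ∀ s t → s ·ᶻ x ≈ᵍ t ·ᶻ x → s ≡ t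
    ·ᶻ-cancelʳ x≉ε (+ m) (+ n) eq =
      ≡.cong +_ (·ⁿ-cancelʳ x≉ε m n (trans (sym (identityʳ _)) (trans (≈ᵍ⇒≈ eq) (identityˡ _))))
    ·ᶻ-cancelʳ x≉ε (+ m) -[1+ n ] eq =
      ⊥-elim (·ⁿ-suc-≉ε x≉ε m n (trans (≈ᵍ⇒≈ eq) (identityˡ ε)))
    ·ᶻ-cancelʳ x≉ε -[1+ m ] (+ n) eq =
      ⊥-elim (·ⁿ-suc-≉ε x≉ε n m (trans (comm _ _) (sym (trans (sym (identityˡ ε)) (≈ᵍ⇒≈ eq)))))
    ·ᶻ-cancelʳ x≉ε -[1+ m ] -[1+ n ] eq = ≡.cong -[1+_] (suc-injective (≡.sym
      (·ⁿ-cancelʳ x≉ε (suc n) (suc m) (trans (sym (identityˡ _)) (trans (≈ᵍ⇒≈ eq) (identityʳ _))))))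

module GroupificationMap {c₁ ℓ₁ c₂ ℓ₂} (M : CommutativeMonoid c₁ ℓ₁) (N : CommutativeMonoid c₂ ℓ₂)
  {f : CommutativeMonoid.Carrier M → CommutativeMonoid.Carrier N} (f-hom : IsHom M N f) where
  open CommutativeMonoid N
  open MonoidMorphisms.IsMonoidHomomorphism f-hom using (homo; ε-homo; ⟦⟧-cong)
  private
    module M = CommutativeMonoid M
    module GM = Groupification M
  open Groupification N

  gpMap : Gp M → Gp N
  gpMap (a , b) = f a , f b

  gpMap-cong : ∀ {X Y} → X GM.≈ᵍ Y → gpMap X ≈ᵍ gpMap Y
  gpMap-cong {a , b} {a' , b'} (k , eq) = f k , (begin
    (f a ∙ f b') ∙ f k      ≈⟨ ∙-congʳ (homo a b') ⟨
    f (a M.∙ b') ∙ f k      ≈⟨ homo _ k ⟨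
    f ((a M.∙ b') M.∙ k)    ≈⟨ ⟦⟧-cong eq ⟩
    f ((b M.∙ a') M.∙ k)    ≈⟨ homo _ k ⟩
    f (b M.∙ a') ∙ f k      ≈⟨ ∙-congʳ (homo b a') ⟩
    (f b ∙ f a') ∙ f k      ∎)
    where
    open import Relation.Binary.Reasoning.Setoid setoid

  gpMap-sub : ∀ X Y → gpMap (X GM.-ᵍ Y) ≈ᵍ gpMap X -ᵍ gpMap Y
  gpMap-sub (a , b) (a' , b') = ≈-pair (homo a b') (homo b a')

  f-·ⁿ : ∀ m x → f (m GM.·ⁿ x) ≈ m ·ⁿ f x
  f-·ⁿ zero    x = ε-homo
  f-·ⁿ (suc m) x = trans (homo x _) (∙-congˡ (f-·ⁿ m x))

  gpMap-·ᶻ : ∀ s x → gpMap (s GM.·ᶻ x) ≈ᵍ s ·ᶻ f x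
  gpMap-·ᶻ (+ m)    x = ≈-pair (f-·ⁿ m x) ε-homo
  gpMap-·ᶻ -[1+ m ] x = ≈-pair ε-homo (f-·ⁿ (suc m) x)

open ≡ using (refl; sym; trans; cong; cong₂; subst; module ≡-Reasoning)

private variable
  m k : ℕ

∑≡sum : (h : Fin k → ℤ) → ∑ h ≡ sum h
∑≡sum {zero}  h = refl
∑≡sum {suc k} h = cong (λ t → h zero + t) (∑≡sum (h ∘ suc))

sum-zero : {h : Fin k → ℤ} → (∀ x → h x ≡ 0ℤ) → sum h ≡ 0ℤ
sum-zero {k} h≡0 = trans (sum-cong-≗ h≡0) (sum-replicate-zero k)

sum-neg : (h : Fin k → ℤ) → sum (λ x → - h x) ≡ - sum h
sum-neg {zero}  h = refl
sum-neg {suc k} h = trans (cong (λ t → - h zero + t) (sum-neg (h ∘ suc)))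
                          (sym (ℤ.neg-distrib-+ (h zero) (sum (h ∘ suc))))

sum-sub : (h h' : Fin k → ℤ) → sum (λ x → h x - h' x) ≡ sum h - sum h'
sum-sub h h' = trans (∑-distrib-+ h (λ x → - h' x)) (cong (λ t → sum h + t) (sum-neg h'))

sum-nonneg : {h : Fin k → ℤ} → (∀ x → 0ℤ ≤ h x) → 0ℤ ≤ sum h
sum-nonneg {zero}  h≥0 = ℤ.≤-refl
sum-nonneg {suc k} h≥0 = ℤ.+-mono-≤ (h≥0 zero) (sum-nonneg (h≥0 ∘ suc))

-- Relies on _≟_ computing: zero ≟ suc x is no, and does (suc a ≟ suc x) is does (a ≟ x).
sum-select : (a : Fin k) (h : Fin k → ℤ) → sum (λ x → if does (a ≟ x) then h x else 0ℤ) ≡ h a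
sum-select {suc k} zero    h =
  trans (cong (λ t → h zero + t) (sum-replicate-zero k)) (ℤ.+-identityʳ (h zero))
sum-select {suc k} (suc a) h = trans (ℤ.+-identityˡ _) (sum-select a (h ∘ suc))

x≡-x⇒x≡0 : ∀ {x} → x ≡ - x → x ≡ 0ℤ
x≡-x⇒x≡0 {+ zero} _ = refl

sum-odd : (ι : Fin k → Fin k) → (∀ x → ι (ι x) ≡ x) →
          {h : Fin k → ℤ} → (∀ x → h (ι x) ≡ - h x) → sum h ≡ 0ℤ
sum-odd ι ι-invol {h} h-odd = x≡-x⇒x≡0 (begin
  sum h                ≡⟨ sum-permute h (permutation ι ι ι-invol ι-invol) ⟩
  sum (h ∘ ι)          ≡⟨ sum-cong-≗ h-odd ⟩
  sum (λ x → - h x)    ≡⟨ sum-neg h ⟩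
  - sum h              ∎)
  where open ≡-Reasoning

if-sum : (b : Bool) (h : Fin k → ℤ) → (if b then sum h else 0ℤ) ≡ sum (λ x → if b then h x else 0ℤ)
if-sum true  h = refl
if-sum {k} false h = sym (sum-zero {k} λ _ → refl)

if-swap : (b c : Bool) (u : ℤ) →
          (if b then (if c then u else 0ℤ) else 0ℤ) ≡ (if c then (if b then u else 0ℤ) else 0ℤ)
if-swap true  c     u = refl
if-swap false true  u = refl
if-swap false false u = refl

if-sub : (b : Bool) (u v : ℤ) → (if b then u - v else 0ℤ) ≡ (if b then u else 0ℤ) - (if b then v else 0ℤ)
if-sub true  u v = refl
if-sub false u v = refl

push : (Fin m → Fin k) → (Fin m → ℤ) → Fin k → ℤ
push p h y = sum (λ x → if does (p x ≟ y) then h x else 0ℤ)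

module _ (p : Fin m → Fin k) where

  push-congʳ : {h h' : Fin m → ℤ} → (∀ x → h x ≡ h' x) → ∀ y → push p h y ≡ push p h' y
  push-congʳ h≗h' y = sum-cong-≗ λ x → cong (if does (p x ≟ y) then_else 0ℤ) (h≗h' x)

  sum-push : (h : Fin m → ℤ) → sum (push p h) ≡ sum h
  sum-push h = trans (∑-comm λ y x → if does (p x ≟ y) then h x else 0ℤ)
                     (sum-cong-≗ λ x → sum-select (p x) (const (h x)))

  push-sub : (h h' : Fin m → ℤ) → ∀ y → push p (λ x → h x - h' x) y ≡ push p h y - push p h' y
  push-sub h h' y = trans (sum-cong-≗ λ x → if-sub (does (p x ≟ y)) (h x) (h' x))
    (sum-sub (λ x → if does (p x ≟ y) then h x else 0ℤ) (λ x → if does (p x ≟ y) then h' x else 0ℤ))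

  push-nonneg : {h : Fin m → ℤ} → (∀ x → 0ℤ ≤ h x) → ∀ y → 0ℤ ≤ push p h y
  push-nonneg {h} h≥0 y = sum-nonneg nonneg
    where
    nonneg : ∀ x → 0ℤ ≤ (if does (p x ≟ y) then h x else 0ℤ)
    nonneg x with p x ≟ y
    ... | yes _ = h≥0 x
    ... | no  _ = ℤ.≤-refl

  push-singleton-fibre : ∀ {a y} → p a ≡ y → (∀ x → p x ≡ y → x ≡ a) → (h : Fin m → ℤ) → push p h y ≡ h a
  push-singleton-fibre {a} {y} pa≡y fibre h = trans (sum-cong-≗ summand) (sum-select a h)
    where
    summand : ∀ x → (if does (p x ≟ y) then h x else 0ℤ) ≡ (if does (a ≟ x) then h x else 0ℤ)
    summand x with p x ≟ y | a ≟ x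
    ... | yes _     | yes _    = refl
    ... | yes px≡y  | no  a≢x  = ⊥-elim (a≢x (sym (fibre x px≡y)))
    ... | no  px≢y  | yes refl = ⊥-elim (px≢y pa≡y)
    ... | no  _     | no  _    = refl

  push-odd : ∀ {y} (ι : Fin m → Fin m) → (∀ x → ι (ι x) ≡ x) → (∀ x → p x ≡ y → p (ι x) ≡ y) →
             {h : Fin m → ℤ} → (∀ x → h (ι x) ≡ - h x) → push p h y ≡ 0ℤ
  push-odd {y} ι ι-invol fibre-closed {h} h-odd = sum-odd ι ι-invol summand-odd
    where
    summand-odd : ∀ x → (if does (p (ι x) ≟ y) then h (ι x) else 0ℤ)
                      ≡ - (if does (p x ≟ y) then h x else 0ℤ)
    summand-odd x with p x ≟ y | p (ι x) ≟ y
    ... | yes _    | yes _     = h-odd x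
    ... | yes px≡y | no  pιx≢y = ⊥-elim (pιx≢y (fibre-closed x px≡y))
    ... | no  px≢y | yes pιx≡y =
      ⊥-elim (px≢y (subst (λ z → p z ≡ y) (ι-invol x) (fibre-closed (ι x) pιx≡y)))
    ... | no  _    | no  _     = refl

push-congˡ : {p p' : Fin m → Fin k} → (∀ x → p x ≡ p' x) →
             (h : Fin m → ℤ) → ∀ y → push p h y ≡ push p' h y
push-congˡ p≗p' h y = sum-cong-≗ λ x → cong (λ z → if does (z ≟ y) then h x else 0ℤ) (p≗p' x)

push-∘ : ∀ {j} (g : Fin k → Fin j) (p : Fin m → Fin k) (h : Fin m → ℤ) →
         ∀ z → push g (push p h) z ≡ push (g ∘ p) h z
push-∘ g p h z = begin
  sum (λ y → if does (g y ≟ z) then sum (λ x → if does (p x ≟ y) then h x else 0ℤ) else 0ℤ)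
    ≡⟨ sum-cong-≗ (λ y → if-sum (does (g y ≟ z)) (λ x → if does (p x ≟ y) then h x else 0ℤ)) ⟩
  sum (λ y → sum (λ x → if does (g y ≟ z) then (if does (p x ≟ y) then h x else 0ℤ) else 0ℤ))
    ≡⟨ ∑-comm (λ y x → if does (g y ≟ z) then (if does (p x ≟ y) then h x else 0ℤ) else 0ℤ) ⟩
  sum (λ x → sum (λ y → if does (g y ≟ z) then (if does (p x ≟ y) then h x else 0ℤ) else 0ℤ))
    ≡⟨ sum-cong-≗ (λ x → sum-cong-≗ λ y → if-swap (does (g y ≟ z)) (does (p x ≟ y)) (h x)) ⟩
  sum (λ x → sum (λ y → if does (p x ≟ y) then (if does (g y ≟ z) then h x else 0ℤ) else 0ℤ))
    ≡⟨ sum-cong-≗ (λ x → sum-select (p x) (λ y → if does (g y ≟ z) then h x else 0ℤ)) ⟩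
  sum (λ x → if does (g (p x) ≟ z) then h x else 0ℤ) ∎
  where open ≡-Reasoning

∑-push : (p : Fin m → Fin k) (h : Fin m → ℤ) → ∑ (push p h) ≡ ∑ h
∑-push p h = trans (∑≡sum (push p h)) (trans (sum-push p h) (sym (∑≡sum h)))

module MetrisedGraphProperties {c ℓ} {M : CommutativeMonoid c ℓ} (Γ : MetrisedGraph M) where
  open MetrisedGraph Γ

  i-vertex : ∀ {x} → r x ≡ x → i x ≡ x
  i-vertex {x} = proj₂ (fixed x)

  i-nonvertex : ∀ {x} → r x ≢ x → r (i x) ≢ i x
  i-nonvertex {x} x-nonvertex rix≡ix =
    x-nonvertex (proj₁ (fixed x) (trans (sym (i-vertex rix≡ix)) (i-invol x)))

  push-IsDivisor : ∀ {m} (p : Fin m → Fin n) {h : Fin m → ℤ} →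
                   (∀ x → r (p x) ≢ p x → h x ≡ 0ℤ) → IsDivisor Γ (push p h)
  push-IsDivisor p {h} h-supp y y-nonvertex = sum-zero summand≡0
    where
    summand≡0 : ∀ x → (if does (p x ≟ y) then h x else 0ℤ) ≡ 0ℤ
    summand≡0 x with p x ≟ y
    ... | yes refl = h-supp x y-nonvertex
    ... | no  _    = refl

  push-r-IsDivisor : ∀ {D} → IsDivisor Γ D → ∀ v → push r D v ≡ D v
  push-r-IsDivisor {D} D-divisor v = trans (sum-cong-≗ summand) (sum-select v D)
    where
    summand : ∀ x → (if does (r x ≟ v) then D x else 0ℤ) ≡ (if does (v ≟ x) then D x else 0ℤ)
    summand x with r x ≟ v | v ≟ x
    ... | yes _    | yes _    = refl
    ... | yes rx≡v | no  v≢x  = D-divisor x λ rx≡x → v≢x (trans (sym rx≡v) rx≡x)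
    ... | no  rx≢v | yes refl = sym (D-divisor x rx≢v)
    ... | no  _    | no  _    = refl

  outgoingSlope : PL Γ → Fin n → ℤ
  outgoingSlope φ e = if does (r e ≟ e) then 0ℤ else PL.slope φ e

  outgoingSlope-vertex : (φ : PL Γ) {e : Fin n} → r e ≡ e → outgoingSlope φ e ≡ 0ℤ
  outgoingSlope-vertex φ {e} e-vertex with r e ≟ e
  ... | yes _           = refl
  ... | no  e-nonvertex = ⊥-elim (e-nonvertex e-vertex)

  outgoingSlope-nonvertex : (φ : PL Γ) {e : Fin n} → r e ≢ e → outgoingSlope φ e ≡ PL.slope φ e
  outgoingSlope-nonvertex φ {e} e-nonvertex with r e ≟ e
  ... | yes e-vertex = ⊥-elim (e-nonvertex e-vertex)
  ... | no  _        = refl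

  Δ≗push-r : (φ : PL Γ) (v : Fin n) → Δ Γ φ v ≡ push r (outgoingSlope φ) v
  Δ≗push-r φ v = trans (∑≡sum {k = n} _) (sum-cong-≗ summand)
    where
    summand : ∀ e → (if does (r e ≟ v) ∧ not (does (e ≟ v)) then PL.slope φ e else 0ℤ)
                  ≡ (if does (r e ≟ v) then outgoingSlope φ e else 0ℤ)
    summand e with r e ≟ v
    ... | no  _    = refl
    ... | yes re≡v with e ≟ v
    ...   | yes e≡v = sym (outgoingSlope-vertex φ (trans re≡v (sym e≡v)))
    ...   | no  e≢v = sym (outgoingSlope-nonvertex φ λ re≡e → e≢v (trans (sym re≡e) re≡v))

  module _ (sharp : Sharp M) (integral : Integral M) where
    open Groupification M
    open Cancellation sharp integral

    slope-i : (φ : PL Γ) {e : Fin n} → r e ≢ e → PL.slope φ (i e) ≡ - PL.slope φ e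
    slope-i φ {e} e-nonvertex =
      ·ᶻ-cancelʳ (e-nonvertex ∘ proj₁ (l-zero e)) (slope (i e)) (- slope e) (begin
      slope (i e) ·ᶻ l e                   ≈⟨ ·ᶻ-cong (slope (i e)) (l-i e) ⟨
      slope (i e) ·ᶻ l (i e)               ≈⟨ slope-spec (i e) (i-nonvertex e-nonvertex) ⟨
      g (r (i e)) -ᵍ g (r (i (i e)))       ≡⟨ cong (λ x → g (r (i e)) -ᵍ g (r x)) (i-invol e) ⟩
      g (r (i e)) -ᵍ g (r e)               ≈⟨ -ᵍ-anticomm (g (r (i e))) (g (r e)) ⟩
      -ᵍ (g (r e) -ᵍ g (r (i e)))          ≈⟨ -ᵍ-cong₁ (slope-spec e e-nonvertex) ⟩
      -ᵍ (slope e ·ᶻ l e)                  ≡⟨ ·ᶻ-neg (slope e) (l e) ⟨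
      (- slope e) ·ᶻ l e                   ∎)
      where
      open PL φ
      open import Relation.Binary.Reasoning.Setoid gpSetoid

    outgoingSlope-i : (φ : PL Γ) (e : Fin n) → outgoingSlope φ (i e) ≡ - outgoingSlope φ e
    outgoingSlope-i φ e with r e ≟ e
    ... | yes e-vertex    =
      trans (cong (outgoingSlope φ) (i-vertex e-vertex)) (outgoingSlope-vertex φ e-vertex)
    ... | no  e-nonvertex =
      trans (outgoingSlope-nonvertex φ (i-nonvertex e-nonvertex)) (slope-i φ e-nonvertex)

  LinSysNonempty-cong : ∀ {D D'} → (∀ x → D x ≡ D' x) → LinSysNonempty Γ D → LinSysNonempty Γ D'
  LinSysNonempty-cong D≗D' (E , E-effective , φ , E-D≡Δφ) =
    E , E-effective , φ , λ x → trans (cong (λ t → E x - t) (sym (D≗D' x))) (E-D≡Δφ x)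

module Contraction {c₁ ℓ₁ c₂ ℓ₂} {M : CommutativeMonoid c₁ ℓ₁} {N : CommutativeMonoid c₂ ℓ₂}
  {Γ : MetrisedGraph M} {f : CommutativeMonoid.Carrier M → CommutativeMonoid.Carrier N}
  (f-hom : IsHom M N f)
  {Γ' : MetrisedGraph N} {q : Fin (MetrisedGraph.n Γ) → Fin (MetrisedGraph.n Γ')}
  (contraction : IsContraction Γ f Γ' q) where

  open MetrisedGraph Γ
  open MetrisedGraphProperties Γ
  open IsContraction contraction using (surjective; kernel; r-comm; i-comm; l-comm)
  open CommutativeMonoid N using () renaming (_≈_ to _≈ᴺ_; ε to εᴺ; sym to ≈ᴺ-sym)
  module Γ' where
    open MetrisedGraph Γ' public
    open MetrisedGraphProperties Γ' public

  s : Fin Γ'.n → Fin n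
  s y = proj₁ (surjective y)

  q-s : ∀ y → q (s y) ≡ y
  q-s y = proj₂ (surjective y)

  q-vertex : ∀ {x} → r x ≡ x → Γ'.r (q x) ≡ q x
  q-vertex {x} x-vertex = trans (sym (r-comm x)) (cong q x-vertex)

  s-nonvertex : ∀ {y} → Γ'.r y ≢ y → r (s y) ≢ s y
  s-nonvertex {y} y-nonvertex = y-nonvertex ∘ subst (λ z → Γ'.r z ≡ z) (q-s y) ∘ q-vertex

  Gen-sym : ∀ {a b} → Gen {N = N} Γ f a b → Gen {N = N} Γ f b a
  Gen-sym (e , fle≈ε , a∈e , b∈e) = e , fle≈ε , b∈e , a∈e

  Gen-vertex : ∀ {a b} → Gen {N = N} Γ f a b → Γ'.r (q a) ≡ q a
  Gen-vertex {a} (e , fle≈ε , a∈e , _) = subst (λ z → Γ'.r z ≡ z) (sym qa≡qre) (q-vertex (r-idem e))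
    where
    qa≡qre : q a ≡ q (r e)
    qa≡qre = proj₂ (kernel a (r e)) (return (e , fle≈ε , a∈e , inj₂ (inj₁ refl)))

  q-injective-over-nonvertex : ∀ {y a b} → Γ'.r y ≢ y → q a ≡ y → q b ≡ y → a ≡ b
  q-injective-over-nonvertex {y} {a} {b} y-nonvertex refl qb≡y = isolated (proj₁ (kernel a b) (sym qb≡y))
    where
    isolated : ∀ {b} → EqClosure (Gen {N = N} Γ f) a b → a ≡ b
    isolated Star.ε         = refl
    isolated (fwd gen ◅ _)  = ⊥-elim (y-nonvertex (Gen-vertex gen))
    isolated (bwd gen ◅ _)  = ⊥-elim (y-nonvertex (Gen-vertex (Gen-sym gen)))

  lift : (Fin Γ'.n → ℤ) → Fin n → ℤ
  lift = push (r ∘ s)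

  push-lift : ∀ {F'} → IsDivisor Γ' F' → ∀ y → push q (lift F') y ≡ F' y
  push-lift {F'} F'-divisor y = begin
    push q (push (r ∘ s) F') y  ≡⟨ push-∘ q (r ∘ s) F' y ⟩
    push (q ∘ r ∘ s) F' y       ≡⟨ push-congˡ q-r-s F' y ⟩
    push Γ'.r F' y              ≡⟨ Γ'.push-r-IsDivisor F'-divisor y ⟩
    F' y                        ∎
    where
    open ≡-Reasoning
    q-r-s : ∀ y → q (r (s y)) ≡ Γ'.r y
    q-r-s y = trans (r-comm (s y)) (cong Γ'.r (q-s y))

  lift-Effective : ∀ {F'} → Effective Γ' F' → Effective Γ (lift F')
  lift-Effective (_ , F'≥0) =
    push-IsDivisor (r ∘ s) (λ y r-rsy≢rsy → ⊥-elim (r-rsy≢rsy (r-idem (s y)))) , push-nonneg (r ∘ s) F'≥0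

  push-IsDivisor-q : ∀ {D} → IsDivisor Γ D → IsDivisor Γ' (push q D)
  push-IsDivisor-q D-divisor =
    Γ'.push-IsDivisor q λ x qx-nonvertex → D-divisor x (qx-nonvertex ∘ q-vertex)

  push-Effective : ∀ {E} → Effective Γ E → Effective Γ' (push q E)
  push-Effective (E-divisor , E≥0) = push-IsDivisor-q E-divisor , push-nonneg q E≥0

  module PushPL (φ : PL Γ) where
    open PL φ
    open GroupificationMap M N f-hom
    open Groupification N
    module GM = Groupification M

    vertexValue : Fin n → Gp N
    vertexValue a = gpMap (g (r a))

    vertexValue-r : ∀ a → vertexValue (r a) ≡ vertexValue a
    vertexValue-r a = cong (gpMap ∘ g) (r-idem a)

    vertexValue-slope : ∀ {e} → r e ≢ e → vertexValue e -ᵍ vertexValue (i e) ≈ᵍ slope e ·ᶻ f (l e)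
    vertexValue-slope {e} e-nonvertex = begin
      gpMap (g (r e)) -ᵍ gpMap (g (r (i e)))   ≈⟨ gpMap-sub (g (r e)) (g (r (i e))) ⟨
      gpMap (g (r e) GM.-ᵍ g (r (i e)))        ≈⟨ gpMap-cong (slope-spec e e-nonvertex) ⟩
      gpMap (slope e GM.·ᶻ l e)                ≈⟨ gpMap-·ᶻ (slope e) (l e) ⟩
      slope e ·ᶻ f (l e)                       ∎
      where open import Relation.Binary.Reasoning.Setoid gpSetoid

    vertexValue-contracted : ∀ {e} → f (l e) ≈ᴺ εᴺ → vertexValue (i e) ≈ᵍ vertexValue e
    vertexValue-contracted {e} fle≈ε with r e ≟ e
    ... | yes e-vertex    = ≈ᵍ-reflexive (cong vertexValue (i-vertex e-vertex))
    ... | no  e-nonvertex = ≈ᵍ-sym (-ᵍ≈0⇒≈ (begin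
      vertexValue e -ᵍ vertexValue (i e)  ≈⟨ vertexValue-slope e-nonvertex ⟩
      slope e ·ᶻ f (l e)                  ≈⟨ ·ᶻ-cong (slope e) fle≈ε ⟩
      slope e ·ᶻ εᴺ                      ≈⟨ ·ᶻ-ε (slope e) ⟩
      0ᵍ                                  ∎))
      where open import Relation.Binary.Reasoning.Setoid gpSetoid

    vertexValue-Among : ∀ {a e} → f (l e) ≈ᴺ εᴺ → Among {N = N} Γ f a e → vertexValue a ≈ᵍ vertexValue e
    vertexValue-Among         fle≈ε (inj₁ refl)                = ≈ᵍ-refl
    vertexValue-Among {e = e} fle≈ε (inj₂ (inj₁ refl))         = ≈ᵍ-reflexive (vertexValue-r e)
    vertexValue-Among         fle≈ε (inj₂ (inj₂ (inj₁ refl)))  = vertexValue-contracted fle≈ε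
    vertexValue-Among {e = e} fle≈ε (inj₂ (inj₂ (inj₂ refl))) =
      ≈ᵍ-trans (≈ᵍ-reflexive (vertexValue-r (i e))) (vertexValue-contracted fle≈ε)

    vertexValue-q : ∀ {a b} → q a ≡ q b → vertexValue a ≈ᵍ vertexValue b
    vertexValue-q {a} {b} qa≡qb =
      gfold ≈ᵍ-isEquivalence vertexValue vertexValue-Gen (proj₁ (kernel a b) qa≡qb)
      where
      vertexValue-Gen : ∀ {a b} → Gen {N = N} Γ f a b → vertexValue a ≈ᵍ vertexValue b
      vertexValue-Gen (e , fle≈ε , a∈e , b∈e) =
        ≈ᵍ-trans (vertexValue-Among fle≈ε a∈e) (≈ᵍ-sym (vertexValue-Among fle≈ε b∈e))

    pushPL-slope-spec : ∀ y → Γ'.r y ≢ y →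
      vertexValue (s (Γ'.r y)) -ᵍ vertexValue (s (Γ'.r (Γ'.i y))) ≈ᵍ slope (s y) ·ᶻ Γ'.l y
    pushPL-slope-spec y y-nonvertex = begin
      vertexValue (s (Γ'.r y)) -ᵍ vertexValue (s (Γ'.r (Γ'.i y)))
        ≈⟨ -ᵍ-cong (vertexValue-q (trans (q-s _) r'y≡qrx)) (vertexValue-q (trans (q-s _) r'i'y≡qrix)) ⟩
      vertexValue (r x) -ᵍ vertexValue (r (i x))
        ≡⟨ cong₂ _-ᵍ_ (vertexValue-r x) (vertexValue-r (i x)) ⟩
      vertexValue x -ᵍ vertexValue (i x)
        ≈⟨ vertexValue-slope (s-nonvertex y-nonvertex) ⟩
      slope x ·ᶻ f (l x)
        ≈⟨ ·ᶻ-cong (slope x) (≈ᴺ-sym (l-comm x)) ⟩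
      slope x ·ᶻ Γ'.l (q x)
        ≡⟨ cong (λ z → slope x ·ᶻ Γ'.l z) (q-s y) ⟩
      slope x ·ᶻ Γ'.l y  ∎
      where
      open import Relation.Binary.Reasoning.Setoid gpSetoid
      x = s y
      r'y≡qrx : Γ'.r y ≡ q (r x)
      r'y≡qrx = trans (cong Γ'.r (sym (q-s y))) (sym (r-comm x))
      r'i'y≡qrix : Γ'.r (Γ'.i y) ≡ q (r (i x))
      r'i'y≡qrix = trans (cong (Γ'.r ∘ Γ'.i) (sym (q-s y)))
                         (trans (cong Γ'.r (sym (i-comm x))) (sym (r-comm (i x))))

    pushPL : PL Γ'
    pushPL = record { g = vertexValue ∘ s ; slope = slope ∘ s ; slope-spec = pushPL-slope-spec }

  open PushPL using (pushPL)

  module _ (sharp : Sharp M) (integral : Integral M) where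

    push-outgoingSlope : ∀ φ y → push q (outgoingSlope φ) y ≡ Γ'.outgoingSlope (pushPL φ) y
    push-outgoingSlope φ y with Γ'.r y ≟ y
    ... | yes y-vertex    = push-odd q i i-invol fibre-i-closed (outgoingSlope-i sharp integral φ)
      where
      fibre-i-closed : ∀ x → q x ≡ y → q (i x) ≡ y
      fibre-i-closed x refl = trans (i-comm x) (Γ'.i-vertex y-vertex)
    ... | no  y-nonvertex = begin
      push q (outgoingSlope φ) y   ≡⟨ push-singleton-fibre q (q-s y) fibre (outgoingSlope φ) ⟩
      outgoingSlope φ (s y)        ≡⟨ outgoingSlope-nonvertex φ (s-nonvertex y-nonvertex) ⟩
      PL.slope φ (s y)             ∎
      where
      open ≡-Reasoning
      fibre : ∀ x → q x ≡ y → x ≡ s y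
      fibre x qx≡y = q-injective-over-nonvertex y-nonvertex qx≡y (q-s y)

    push-Δ : ∀ φ y → push q (Δ Γ φ) y ≡ Δ Γ' (pushPL φ) y
    push-Δ φ y = begin
      push q (Δ Γ φ) y                            ≡⟨ push-congʳ q (Δ≗push-r φ) y ⟩
      push q (push r σ) y                         ≡⟨ push-∘ q r σ y ⟩
      push (q ∘ r) σ y                            ≡⟨ push-congˡ r-comm σ y ⟩
      push (Γ'.r ∘ q) σ y                         ≡⟨ push-∘ Γ'.r q σ y ⟨
      push Γ'.r (push q σ) y                      ≡⟨ push-congʳ Γ'.r (push-outgoingSlope φ) y ⟩
      push Γ'.r (Γ'.outgoingSlope (pushPL φ)) y   ≡⟨ Γ'.Δ≗push-r (pushPL φ) y ⟨
      Δ Γ' (pushPL φ) y                           ∎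
      where
      open ≡-Reasoning
      σ = outgoingSlope φ

    push-∼ : ∀ {E D} → _∼_ Γ E D → _∼_ Γ' (push q E) (push q D)
    push-∼ {E} {D} (φ , E-D≡Δφ) = pushPL φ , λ y → begin
      push q E y - push q D y      ≡⟨ push-sub q E D y ⟨
      push q (λ x → E x - D x) y   ≡⟨ push-congʳ q E-D≡Δφ y ⟩
      push q (Δ Γ φ) y             ≡⟨ push-Δ φ y ⟩
      Δ Γ' (pushPL φ) y            ∎
      where open ≡-Reasoning

    push-LinSysNonempty : ∀ {D} → LinSysNonempty Γ D → LinSysNonempty Γ' (push q D)
    push-LinSysNonempty (E , E-effective , E∼D) = push q E , push-Effective E-effective , push-∼ E∼D

    push-RankWitness : ∀ {D k} → RankWitness Γ D k → RankWitness Γ' (push q D) k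
    push-RankWitness {D} {k} W F' F'-effective deg-F'≡k =
      Γ'.LinSysNonempty-cong push-D-lift
        (push-LinSysNonempty (W (lift F') (lift-Effective F'-effective) deg-lift))
      where
      deg-lift : deg Γ (lift F') ≡ + k
      deg-lift = trans (∑-push (r ∘ s) F') deg-F'≡k
      push-D-lift : ∀ y → push q (λ x → D x - lift F' x) y ≡ push q D y - F' y
      push-D-lift y = trans (push-sub q D (lift F') y)
                            (cong (λ t → push q D y - t) (push-lift (proj₁ F'-effective) y))

corollary4p6 : ∀ {c₁ ℓ₁ c₂ ℓ₂}
    (M : CommutativeMonoid c₁ ℓ₁) (N : CommutativeMonoid c₂ ℓ₂) →
    Sharp M → Integral M → Sharp N → Integral N →
    (Γ : MetrisedGraph M) →
    (f : CommutativeMonoid.Carrier M → CommutativeMonoid.Carrier N) → IsHom M N f →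
    (Γ' : MetrisedGraph N) (q : Fin (MetrisedGraph.n Γ) → Fin (MetrisedGraph.n Γ')) →
    IsContraction Γ f Γ' q →
    ∀ (D : Fin (MetrisedGraph.n Γ) → ℤ) → IsDivisor Γ D → RankAtLeastOne Γ D →
    ∃[ D' ] (IsDivisor Γ' D' × RankAtLeastOne Γ' D' × deg Γ' D' ≤ deg Γ D)
-- Slopes on Γ' are inherited from Γ, so N need not be sharp or integral.
corollary4p6 M N sharp integral _ _ Γ f f-hom Γ' q contraction D D-divisor (k , 1≤k , W) =
  push q D , push-IsDivisor-q D-divisor , (k , 1≤k , push-RankWitness sharp integral W) ,
  ℤ.≤-reflexive (∑-push q D)
  where open Contraction f-hom contraction
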